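{- For any non-empty string $S$, let $U = \{u : |f^{ -1}(u)| = 2\}$. Then $|U| \leq |\mathcal{M}_S| - 1$.
   Context: For a string $S$ of length $n$ and $1 \le i \le j \le n$, $S[i..j]$ is the substring from position $i$ to position $j$; a non-empty substring is unique if it occurs exactly once in $S$ and repeating if it occurs at least twice; an interval $[i,j]$ is unique/repeating according to $S[i..j]$. An interval $[i,j]$ is a minimal unique substring (MUS) if $S[i..j]$ is unique and every proper substring $S[i'..j']$ ($i\le i'$, $j'\le j$, $j'-i'<j-i$) is repeating; $\mathcal{M}_S$ is the set of all MUS intervals. $[s,t]\subset[i,j]$ means $i\le s$ and $t\le j$. An interval $[i,j]$ is a shortest unique substring (SUS) for $[s,t]$ if $S[i..j]$ is unique, $[s,t]\subset[i,j]$, and $S[i'..j']$ is repeating for every $[i',j']\supset[s,t]$ with $j'-i'<j-i$. $\mathsf{SUS}_S(p)$ is the set of SUSs for $[p,p]$ and $\mathcal{PS}_S=\bigcup_{p=1}^n\mathsf{SUS}_S(p)$. Let $\mathcal{LS}_S=\mathcal{PS}_S\cap\{[x,y]\notin\mathcal{M}_S : \exists i,\ x<i\le y,\ [i,y]\in\mathcal{M}_S\}$, $\mathcal{MS}_S=\mathcal{PS}_S\cap\mathcal{M}_S$, and $\mathcal{RS}_S=\mathcal{PS}_S\cap\{[x,y]\notin\mathcal{M}_S : \exists j,\ x\le j<y,\ [x,j]\in\mathcal{M}_S\}$; these three sets are pairwise disjoint and their union is $\mathcal{PS}_S$. Define $f:\mathcal{PS}_S\to\{1,\dots,n\}$ by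 $f([x,y])=x$ if $[x,y]\in\mathcal{LS}_S\cup\mathcal{MS}_S$ and $f([x,y])=y$ if $[x,y]\in\mathcal{RS}_S$, and for $u\in\{1,\dots,n\}$, $f^{ -1}(u)=\{[x,y]\in\mathcal{PS}_S : f([x,y])=u\}$. -}

module Defs where

open import Data.Bool using (Bool; true; false; _∧_; _∨_; not; if_then_else_)
open import Data.Nat using (ℕ; zero; suc; _+_; _∸_; _≤ᵇ_; _<ᵇ_; _≡ᵇ_)
open import Data.List using (List; []; _∷_; length; take; drop; map; upTo; filterᵇ; concatMap)
open import Data.Bool.ListAction using (all; any)
open import Data.Product using (_×_; _,_)
open import Relation.Nullary using (does)
open import Relation.Binary.PropositionalEquality using (_≡_)
open import Relation.Binary.Definitions using (DecidableEquality)
import Data.List.Properties as LP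

-- range a b = [a, a+1, ..., b]  (empty if b < a)
range : ℕ → ℕ → List ℕ
range a b = map (a +_) (upTo (suc b ∸ a))

-- Everything is relative to a string S over an alphabet A with decidable equality.
-- Positions are 1-based: 1 .. n with n = length S.  An interval [i,j] is a pair (i , j).
module Str {A : Set} (_≟_ : DecidableEquality A) (S : List A) where

  n : ℕ
  n = length S

  Interval : Set
  Interval = ℕ × ℕ

  sub : ℕ → ℕ → List A
  sub i j = take (suc (j ∸ i)) (drop (i ∸ 1) S)

  valid : ℕ → ℕ → Bool
  valid i j = (1 ≤ᵇ i) ∧ (i ≤ᵇ j) ∧ (j ≤ᵇ n)

  sameStr : List A → List A → Bool
  sameStr u v = does (LP.≡-dec _≟_ u v)

  occ : ℕ → ℕ → ℕ
  occ i j = length (filterᵇ (λ k → valid k (k + (j ∸ i)) ∧ sameStr (sub k (k + (j ∸ i))) (sub i j)) (range 1 n))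

  unique : ℕ → ℕ → Bool
  unique i j = occ i j ≡ᵇ 1

  repeating : ℕ → ℕ → Bool
  repeating i j = 2 ≤ᵇ occ i j

  intervals : List Interval
  intervals = concatMap (λ i → map (λ j → (i , j)) (range i n)) (range 1 n)

  isMUS : Interval → Bool
  isMUS (i , j) =
    valid i j ∧ unique i j ∧
    all (λ i' → all (λ j' → not (j' ∸ i' <ᵇ j ∸ i) ∨ repeating i' j') (range i' j)) (range i j)

  isSUS : Interval → Interval → Bool
  isSUS (s , t) (i , j) =
    valid i j ∧ unique i j ∧ (i ≤ᵇ s) ∧ (t ≤ᵇ j) ∧
    all (λ i' → all (λ j' → not (j' ∸ i' <ᵇ j ∸ i) ∨ repeating i' j') (range t n)) (range 1 s)

  inPS : Interval → Bool
  inPS I = any (λ p → isSUS (p , p) I) (range 1 n)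

  inLS : Interval → Bool
  inLS (x , y) = inPS (x , y) ∧ not (isMUS (x , y)) ∧ any (λ i → (x <ᵇ i) ∧ isMUS (i , y)) (range 1 n)

  inMS : Interval → Bool
  inMS I = inPS I ∧ isMUS I

  inRS : Interval → Bool
  inRS (x , y) = inPS (x , y) ∧ not (isMUS (x , y)) ∧ any (λ j → (j <ᵇ y) ∧ isMUS (x , j)) (range x n)

  -- f([x,y]) = x on LS ∪ MS, y otherwise (i.e. on RS, since LS, MS, RS partition PS)
  f : Interval → ℕ
  f (x , y) = if inLS (x , y) ∨ inMS (x , y) then x else y

  fInvCard : ℕ → ℕ
  fInvCard u = length (filterᵇ (λ I → inPS I ∧ (f I ≡ᵇ u)) intervals)

  cardM : ℕ
  cardM = length (filterᵇ isMUS intervals)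

  cardU : ℕ
  cardU = length (filterᵇ (λ u → fInvCard u ≡ᵇ 2) (range 1 n))

-- A position u with |f⁻¹(u)| = 2 has one preimage [u,y] in LS ∪ MS and one preimage [x,u] in RS: two preimages
-- of the same kind would yield a unique interval contradicting the minimality of one of the SUSs (or of a MUS).
-- The left preimage ends in a MUS [i,y] with u ≤ i; the right one is a SUS of u itself with a unique proper
-- prefix [x,b], b < u.  Charging u to [i,y] is injective, and the MUS with the smallest end is never charged,
-- since the unique prefix [x,b] contains a MUS ending at most at b < u ≤ y.
module Submission where

open import Data.Bool using (Bool; true; false; T; not; _∧_; _∨_; if_then_else_)
open import Data.Bool.Properties using (T-∧; T-∨)
open import Data.Bool.ListAction using (all; any)
open import Data.Empty using (⊥; ⊥-elim)
open import Data.List using (List; []; _∷_; length; take; drop; map; filterᵇ)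
open import Data.List.Properties using (take-drop; take-take; drop-drop; length-removeAt′; ≡-dec)
open import Data.List.Extrema.Nat using (argmin; argmin-sel; f[argmin]≤f[xs])
open import Data.List.Membership.Propositional using (_∈_; find; lose)
open import Data.List.Membership.Propositional.Properties
  using (∈-map⁺; ∈-map⁻; ∈-upTo⁺; ∈-upTo⁻; ∈-filter⁺; ∈-filter⁻; ∈-concat⁺′; ∈-length)
import Data.List.Relation.Unary.All as All
open import Data.List.Relation.Unary.All using (_∷_)
import Data.List.Relation.Unary.All.Properties as All
open import Data.List.Relation.Unary.All.Properties using (all⁺; all⁻; ¬All⇒Any¬)
import Data.List.Relation.Unary.AllPairs as AllPairs
open import Data.List.Relation.Unary.AllPairs using (_∷_)
import Data.List.Relation.Unary.AllPairs.Properties as AllPairs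
open import Data.List.Relation.Unary.Any using (here; there; index; _─_)
open import Data.List.Relation.Unary.Any.Properties using (any⁺; any⁻)
open import Data.List.Relation.Unary.Unique.Propositional using (Unique)
import Data.List.Relation.Unary.Unique.Propositional.Properties as Unique
open import Data.Nat using (ℕ; suc; _+_; _∸_; _⊔_; _≤_; _<_; _<ᵇ_; _≡ᵇ_; z≤n; s≤s; s≤s⁻¹)
import Data.Nat as ℕ
open import Data.Nat.Properties
open import Data.Product using (∃; ∃₂; _×_; _,_; proj₁; proj₂)
open import Data.Sum using (_⊎_; inj₁; inj₂)
open import Function using (_∘_; Equivalence)
open import Relation.Binary.Definitions using (DecidableEquality; tri<; tri≈; tri>)
open import Relation.Binary.PropositionalEquality
open import Relation.Nullary using (¬_; Dec; yes; no)
open import Relation.Nullary.Decidable using (T?)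

open import Defs

open Equivalence using (to; from)

¬T⇒T-not : ∀ {b} → ¬ T b → T (not b)
¬T⇒T-not {false} _ = _
¬T⇒T-not {true} ¬t = ¬t _

if-T : ∀ {X : Set} {b} {x y : X} → T b → (if b then x else y) ≡ x
if-T {b = true} _ = refl

if-¬T : ∀ {X : Set} {b} {x y : X} → ¬ T b → (if b then x else y) ≡ y
if-¬T {b = false} _ = refl
if-¬T {b = true} ¬t = ⊥-elim (¬t _)

all-lookup : ∀ {X : Set} {p : X → Bool} {xs x} → T (all p xs) → x ∈ xs → T (p x)
all-lookup {p = p} {xs} t = All.lookup (all⁺ p xs t)

¬all⇒∃¬ : ∀ {X : Set} (p : X → Bool) xs → ¬ T (all p xs) → ∃ λ x → x ∈ xs × ¬ T (p x)
¬all⇒∃¬ p xs ¬all = find (¬All⇒Any¬ (T? ∘ p) xs (¬all ∘ all⁻ p))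

∈-filterᵇ⁺ : ∀ {X : Set} (p : X → Bool) {xs x} → x ∈ xs → T (p x) → x ∈ filterᵇ p xs
∈-filterᵇ⁺ p = ∈-filter⁺ (T? ∘ p)

∈-filterᵇ⁻ : ∀ {X : Set} (p : X → Bool) {xs x} → x ∈ filterᵇ p xs → x ∈ xs × T (p x)
∈-filterᵇ⁻ p = ∈-filter⁻ (T? ∘ p)

filterᵇ-Unique : ∀ {X : Set} (p : X → Bool) {xs} → Unique xs → Unique (filterᵇ p xs)
filterᵇ-Unique p = Unique.filter⁺ (T? ∘ p)

distinct⇒2≤length : ∀ {X : Set} {xs : List X} {x y} → x ∈ xs → y ∈ xs → x ≢ y → 2 ≤ length xs
distinct⇒2≤length (here refl) (here refl) x≢y = ⊥-elim (x≢y refl)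
distinct⇒2≤length (here refl) (there y∈) _ = s≤s (∈-length y∈)
distinct⇒2≤length (there x∈) (here refl) _ = s≤s (∈-length x∈)
distinct⇒2≤length (there x∈) (there y∈) x≢y = m≤n⇒m≤1+n (distinct⇒2≤length x∈ y∈ x≢y)

Unique⇒distinct : ∀ {X : Set} {xs : List X} → Unique xs → 2 ≤ length xs →
  ∃₂ λ x y → x ≢ y × x ∈ xs × y ∈ xs
Unique⇒distinct {xs = _ ∷ []} _ (s≤s ())
Unique⇒distinct {xs = _ ∷ _ ∷ _} ((x≢y ∷ _) ∷ _) _ = _ , _ , x≢y , here refl , there (here refl)

Unique-constant⇒length≤1 : ∀ {X : Set} {xs : List X} {a} → Unique xs → (∀ {x} → x ∈ xs → x ≡ a) →
  length xs ≤ 1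
Unique-constant⇒length≤1 {xs = []} _ _ = z≤n
Unique-constant⇒length≤1 {xs = _ ∷ []} _ _ = s≤s z≤n
Unique-constant⇒length≤1 {xs = _ ∷ _ ∷ _} ((x≢y ∷ _) ∷ _) ≡a =
  ⊥-elim (x≢y (trans (≡a (here refl)) (sym (≡a (there (here refl))))))

∈-─ : ∀ {X : Set} {xs : List X} {x y} (y∈ : y ∈ xs) → x ∈ xs → x ≢ y → x ∈ (xs ─ y∈)
∈-─ (here refl) (here refl) x≢y = ⊥-elim (x≢y refl)
∈-─ (here refl) (there x∈) _ = x∈
∈-─ (there y∈) (here refl) _ = here refl
∈-─ (there y∈) (there x∈) x≢y = there (∈-─ y∈ x∈ x≢y)

length<-by-injection : ∀ {X Y : Set} (R : X → Y → Set) {xs : List X} {ys : List Y} {y₀} →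
  Unique xs → (∀ {x} → x ∈ xs → ∃ λ y → y ∈ ys × R x y) → (∀ {x x′ y} → R x y → R x′ y → x ≡ x′) →
  y₀ ∈ ys → (∀ {x} → ¬ R x y₀) → length xs < length ys
length<-by-injection R {[]} _ _ _ y₀∈ _ = ∈-length y₀∈
length<-by-injection R {x ∷ xs} {ys} {y₀} (x∉xs ∷ xs-unique) image injective y₀∈ y₀-missed
  with image (here refl)
... | y , y∈ , Rxy =
  subst (length (x ∷ xs) <_) (sym (length-removeAt′ ys (index y∈)))
    (s≤s (length<-by-injection R xs-unique image′ injective (∈-─ y∈ y₀∈ y₀≢y) y₀-missed))
  where
  y₀≢y : y₀ ≢ y
  y₀≢y refl = y₀-missed Rxy
  image′ : ∀ {x′} → x′ ∈ xs → ∃ λ y′ → y′ ∈ (ys ─ y∈) × R x′ y′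
  image′ x′∈ with image (there x′∈)
  ... | y′ , y′∈ , Rx′y′ =
    y′ , ∈-─ y∈ y′∈ (λ { refl → All.lookup x∉xs x′∈ (sym (injective Rx′y′ Rxy)) }) , Rx′y′

take-drop-take : ∀ {X : Set} a b c (xs : List X) → b + a ≤ c →
  take a (drop b (take c xs)) ≡ take a (drop b xs)
take-drop-take a b c xs b+a≤c = begin
  take a (drop b (take c xs))       ≡⟨ take-drop a b (take c xs) ⟩
  drop b (take (b + a) (take c xs)) ≡⟨ cong (drop b) (take-take (b + a) c xs) ⟩
  drop b (take ((b + a) ℕ.⊓ c) xs)  ≡⟨ cong (λ m → drop b (take m xs)) (m≤n⇒m⊓n≡m b+a≤c) ⟩
  drop b (take (b + a) xs)          ≡⟨ take-drop a b xs ⟨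
  take a (drop b xs)                ∎
  where open ≡-Reasoning

∈-range⁺ : ∀ {a b x} → a ≤ x → x ≤ b → x ∈ range a b
∈-range⁺ {a} {b} a≤x x≤b =
  subst (_∈ range a b) (m+[n∸m]≡n a≤x) (∈-map⁺ (a +_) (∈-upTo⁺ (∸-monoˡ-< (s≤s x≤b) a≤x)))

∈-range⁻ : ∀ {a b x} → x ∈ range a b → a ≤ x × x ≤ b
∈-range⁻ {a} {b} x∈ with ∈-map⁻ (a +_) x∈
... | k , k∈ , refl = m≤m+n a k , (begin
  a + k ≡⟨ +-comm a k ⟩
  k + a ≤⟨ s≤s⁻¹ (m≤o∸n⇒m+n≤o (suc k) (<⇒≤ a<1+b) k<) ⟩
  b     ∎)
  where
  open ≤-Reasoning
  k< : k < suc b ∸ a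
  k< = ∈-upTo⁻ k∈
  a<1+b : a < suc b
  a<1+b = m∸n≢0⇒n<m (λ eq → n≮0 (subst (k <_) eq k<))

range-Unique : ∀ a b → Unique (range a b)
range-Unique a b = Unique.map⁺ (+-cancelˡ-≡ a _ _) (Unique.upTo⁺ _)

<-impossible⇒≡ : ∀ {P : ℕ → Set} → (∀ {a b} → P a → P b → a < b → ⊥) → ∀ {a b} → P a → P b → a ≡ b
<-impossible⇒≡ impossible {a} {b} pa pb with <-cmp a b
... | tri< a<b _ _ = ⊥-elim (impossible pa pb a<b)
... | tri≈ _ a≡b _ = a≡b
... | tri> _ _ b<a = ⊥-elim (impossible pb pa b<a)

module StringIntervals {A : Set} (_≟_ : DecidableEquality A) (S : List A) where
  open Str _≟_ S

  record Valid (i j : ℕ) : Set where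
    constructor mkValid
    field
      1≤i : 1 ≤ i
      i≤j : i ≤ j
      j≤n : j ≤ n

  valid⇒Valid : ∀ {i j} → T (valid i j) → Valid i j
  valid⇒Valid {i} {j} t =
    let 1≤ᵇi , rest = to T-∧ t
        i≤ᵇj , j≤ᵇn = to T-∧ rest
    in mkValid (≤ᵇ⇒≤ 1 i 1≤ᵇi) (≤ᵇ⇒≤ i j i≤ᵇj) (≤ᵇ⇒≤ j n j≤ᵇn)

  Valid⇒valid : ∀ {i j} → Valid i j → T (valid i j)
  Valid⇒valid (mkValid 1≤i i≤j j≤n) = from T-∧ (≤⇒≤ᵇ 1≤i , from T-∧ (≤⇒≤ᵇ i≤j , ≤⇒≤ᵇ j≤n))

  sameStr⇒≡ : ∀ {u v} → T (sameStr u v) → u ≡ v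
  sameStr⇒≡ {u} {v} t with ≡-dec _≟_ u v
  ... | yes u≡v = u≡v
  ... | no _ = ⊥-elim t

  ≡⇒sameStr : ∀ {u v} → u ≡ v → T (sameStr u v)
  ≡⇒sameStr {u} {v} u≡v with ≡-dec _≟_ u v
  ... | yes _ = _
  ... | no u≢v = u≢v u≡v

  occursAt : ℕ → ℕ → ℕ → Bool
  occursAt i j k = valid k (k + (j ∸ i)) ∧ sameStr (sub k (k + (j ∸ i))) (sub i j)

  OccursAt : ℕ → ℕ → ℕ → Set
  OccursAt i j k = Valid k (k + (j ∸ i)) × sub k (k + (j ∸ i)) ≡ sub i j

  occursAt⇒OccursAt : ∀ {i j k} → T (occursAt i j k) → OccursAt i j k
  occursAt⇒OccursAt t = let v , same = to T-∧ t in valid⇒Valid v , sameStr⇒≡ same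

  OccursAt⇒∈occurrences : ∀ {i j k} → OccursAt i j k → k ∈ filterᵇ (occursAt i j) (range 1 n)
  OccursAt⇒∈occurrences (v , same) =
    ∈-filterᵇ⁺ _ (∈-range⁺ (Valid.1≤i v) (≤-trans (m≤m+n _ _) (Valid.j≤n v)))
      (from T-∧ (Valid⇒valid v , ≡⇒sameStr same))

  OccursAt-self : ∀ {i j} → Valid i j → OccursAt i j i
  OccursAt-self {i} {j} (mkValid 1≤i i≤j j≤n) =
    subst (λ e → Valid i e × sub i e ≡ sub i j) (sym (m+[n∸m]≡n i≤j)) (mkValid 1≤i i≤j j≤n , refl)

  sub-window : ∀ x e δ d → 1 ≤ x → δ + d ≤ e →
    sub (x + δ) (x + δ + d) ≡ take (suc d) (drop δ (sub x (x + e)))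
  sub-window x e δ d 1≤x δ+d≤e = begin
    take (suc (x + δ + d ∸ (x + δ))) (drop (x + δ ∸ 1) S)
      ≡⟨ cong₂ (λ l m → take (suc l) (drop m S)) (m+n∸m≡n (x + δ) d) (+-∸-comm δ 1≤x) ⟩
    take (suc d) (drop (x ∸ 1 + δ) S)
      ≡⟨ cong (take (suc d)) (drop-drop (x ∸ 1) δ S) ⟨
    take (suc d) (drop δ (drop (x ∸ 1) S))
      ≡⟨ take-drop-take (suc d) δ (suc e) (drop (x ∸ 1) S) (subst (_≤ suc e) (sym (+-suc δ d)) (s≤s δ+d≤e))
       ⟨
    take (suc d) (drop δ (take (suc e) (drop (x ∸ 1) S)))
      ≡⟨ cong (λ l → take (suc d) (drop δ (take (suc l) (drop (x ∸ 1) S)))) (m+n∸m≡n x e) ⟨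
    take (suc d) (drop δ (sub x (x + e)))
      ∎
    where open ≡-Reasoning

  OccursAt-shift : ∀ {i′ j′ i j k} → Valid i′ j′ → i′ ≤ i → i ≤ j → j ≤ j′ →
    OccursAt i′ j′ k → OccursAt i j (k + (i ∸ i′))
  OccursAt-shift {i′} {j′} {i} {j} {k} v′ i′≤i i≤j j≤j′ (vk , same) = v , same′
    where
    D = j′ ∸ i′
    δ = i ∸ i′
    d = j ∸ i
    i′+D≡j′ : i′ + D ≡ j′
    i′+D≡j′ = m+[n∸m]≡n (≤-trans i′≤i (≤-trans i≤j j≤j′))
    i′+δ≡i : i′ + δ ≡ i
    i′+δ≡i = m+[n∸m]≡n i′≤i
    i+d≡j : i + d ≡ j
    i+d≡j = m+[n∸m]≡n i≤j
    δ+d≤D : δ + d ≤ D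
    δ+d≤D = +-cancelˡ-≤ i′ _ _ (begin
      i′ + (δ + d) ≡⟨ +-assoc i′ δ d ⟨
      i′ + δ + d   ≡⟨ cong (_+ d) i′+δ≡i ⟩
      i + d        ≡⟨ i+d≡j ⟩
      j            ≤⟨ j≤j′ ⟩
      j′           ≡⟨ i′+D≡j′ ⟨
      i′ + D       ∎)
      where open ≤-Reasoning
    v : Valid (k + δ) (k + δ + d)
    v = mkValid (≤-trans (Valid.1≤i vk) (m≤m+n k δ)) (m≤m+n (k + δ) d)
          (≤-trans (subst (_≤ k + D) (sym (+-assoc k δ d)) (+-monoʳ-≤ k δ+d≤D)) (Valid.j≤n vk))
    same′ : sub (k + δ) (k + δ + d) ≡ sub i j
    same′ = begin
      sub (k + δ) (k + δ + d)                   ≡⟨ sub-window k D δ d (Valid.1≤i vk) δ+d≤D ⟩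
      take (suc d) (drop δ (sub k (k + D)))     ≡⟨ cong (take (suc d) ∘ drop δ) same ⟩
      take (suc d) (drop δ (sub i′ j′))         ≡⟨ cong (λ e → take (suc d) (drop δ (sub i′ e))) i′+D≡j′ ⟨
      take (suc d) (drop δ (sub i′ (i′ + D)))   ≡⟨ sub-window i′ D δ d (Valid.1≤i v′) δ+d≤D ⟨
      sub (i′ + δ) (i′ + δ + d)                 ≡⟨ cong (λ s → sub s (s + d)) i′+δ≡i ⟩
      sub i (i + d)                             ≡⟨ cong (sub i) i+d≡j ⟩
      sub i j                                   ∎
      where open ≡-Reasoning

  record IsUnique (i j : ℕ) : Set where
    field
      bounds : Valid i j
      only-occurrence : ∀ {k} → OccursAt i j k → k ≡ i
    open Valid bounds public

  IsUnique⇒occ≤1 : ∀ {i j} → IsUnique i j → occ i j ≤ 1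
  IsUnique⇒occ≤1 {i} {j} u =
    Unique-constant⇒length≤1 (filterᵇ-Unique (occursAt i j) {range 1 n} (range-Unique 1 n)) λ {k} k∈ →
      IsUnique.only-occurrence u (occursAt⇒OccursAt {i} {j} {k} (proj₂ (∈-filterᵇ⁻ (occursAt i j) {range 1 n} k∈)))

  occ≤1⇒IsUnique : ∀ {i j} → Valid i j → occ i j ≤ 1 → IsUnique i j
  occ≤1⇒IsUnique {i} {j} v occ≤1 = record { bounds = v ; only-occurrence = only }
    where
    only : ∀ {k} → OccursAt i j k → k ≡ i
    only {k} k-occ with k ℕ.≟ i
    ... | yes k≡i = k≡i
    ... | no k≢i = ⊥-elim (1+n≰n (≤-trans
      (distinct⇒2≤length (OccursAt⇒∈occurrences {i} {j} k-occ)
                         (OccursAt⇒∈occurrences {i} {j} (OccursAt-self v)) k≢i)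
      occ≤1))

  IsUnique⇒unique : ∀ {i j} → IsUnique i j → T (unique i j)
  IsUnique⇒unique {i} {j} u = ≡⇒≡ᵇ (occ i j) 1 (≤-antisym (IsUnique⇒occ≤1 u)
    (∈-length (OccursAt⇒∈occurrences {i} {j} (OccursAt-self (IsUnique.bounds u)))))

  unique⇒IsUnique : ∀ {i j} → Valid i j → T (unique i j) → IsUnique i j
  unique⇒IsUnique {i} {j} v t = occ≤1⇒IsUnique v (≤-reflexive (≡ᵇ⇒≡ (occ i j) 1 t))

  IsUnique⇒¬repeating : ∀ {i j} → IsUnique i j → ¬ T (repeating i j)
  IsUnique⇒¬repeating {i} {j} u rep = 1+n≰n (≤-trans (≤ᵇ⇒≤ 2 (occ i j) rep) (IsUnique⇒occ≤1 u))

  ¬repeating⇒IsUnique : ∀ {i j} → Valid i j → ¬ T (repeating i j) → IsUnique i j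
  ¬repeating⇒IsUnique v ¬rep = occ≤1⇒IsUnique v (s≤s⁻¹ (≰⇒> (¬rep ∘ ≤⇒≤ᵇ)))

  -- An occurrence of S[i′..j′] at k contains an occurrence of S[i..j] at k + (i - i′).
  IsUnique-⊇ : ∀ {i′ j′ i j} → Valid i′ j′ → i′ ≤ i → j ≤ j′ → IsUnique i j → IsUnique i′ j′
  IsUnique-⊇ {i′} {j′} {i} {j} v′ i′≤i j≤j′ u = record { bounds = v′ ; only-occurrence = only }
    where
    only : ∀ {k} → OccursAt i′ j′ k → k ≡ i′
    only {k} k-occ = +-cancelʳ-≡ (i ∸ i′) k i′ (begin
      k + (i ∸ i′)  ≡⟨ IsUnique.only-occurrence u (OccursAt-shift v′ i′≤i (IsUnique.i≤j u) j≤j′ k-occ) ⟩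
      i             ≡⟨ m+[n∸m]≡n i′≤i ⟨
      i′ + (i ∸ i′) ∎)
      where open ≡-Reasoning

  IsUnique-extendˡ : ∀ {i′ i j} → 1 ≤ i′ → i′ ≤ i → IsUnique i j → IsUnique i′ j
  IsUnique-extendˡ 1≤i′ i′≤i u =
    IsUnique-⊇ (mkValid 1≤i′ (≤-trans i′≤i (IsUnique.i≤j u)) (IsUnique.j≤n u)) i′≤i ≤-refl u

  IsUnique-extendʳ : ∀ {i j j′} → j ≤ j′ → j′ ≤ n → IsUnique i j → IsUnique i j′
  IsUnique-extendʳ j≤j′ j′≤n u =
    IsUnique-⊇ (mkValid (IsUnique.1≤i u) (≤-trans (IsUnique.i≤j u) j≤j′) j′≤n) ≤-refl j≤j′ u

  IsUnique-whole : 1 ≤ n → IsUnique 1 n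
  IsUnique-whole 1≤n = record { bounds = mkValid ≤-refl 1≤n ≤-refl ; only-occurrence = only }
    where
    only : ∀ {k} → OccursAt 1 n k → k ≡ 1
    only {k} (mkValid 1≤k _ k+[n∸1]≤n , _) =
      ≤-antisym (+-cancelʳ-≤ (n ∸ 1) k 1 (subst (k + (n ∸ 1) ≤_) (sym (m+[n∸m]≡n 1≤n)) k+[n∸1]≤n)) 1≤k

  record IsMUS (i j : ℕ) : Set where
    field
      isUnique : IsUnique i j
      minimal : ∀ {i′ j′} → i ≤ i′ → j′ ≤ j → IsUnique i′ j′ → j ∸ i ≤ j′ ∸ i′

  record IsSUS (p i j : ℕ) : Set where
    field
      isUnique : IsUnique i j
      i≤p : i ≤ p
      p≤j : p ≤ j
      shortest : ∀ {i′ j′} → i′ ≤ p → p ≤ j′ → IsUnique i′ j′ → j ∸ i ≤ j′ ∸ i′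

  -- The test that isMUS and isSUS apply to every candidate [i,j], for a reference length len.
  notShorterOrRepeats : ℕ → ℕ → ℕ → Bool
  notShorterOrRepeats len i j = not (j ∸ i <ᵇ len) ∨ repeating i j

  notShorterOrRepeats-unique : ∀ {len i j} → T (notShorterOrRepeats len i j) → IsUnique i j → len ≤ j ∸ i
  notShorterOrRepeats-unique {len} {i} {j} t u with j ∸ i <ᵇ len in lt
  ... | false = ≮⇒≥ (λ j∸i<len → subst T lt (<⇒<ᵇ j∸i<len))
  ... | true = ⊥-elim (IsUnique⇒¬repeating u t)

  ¬notShorterOrRepeats : ∀ {len i j} → Valid i j → ¬ T (notShorterOrRepeats len i j) →
    j ∸ i < len × IsUnique i j
  ¬notShorterOrRepeats {len} {i} {j} v ¬t with j ∸ i <ᵇ len in lt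
  ... | false = ⊥-elim (¬t _)
  ... | true = <ᵇ⇒< (j ∸ i) len (subst T (sym lt) _) , ¬repeating⇒IsUnique v ¬t

  isMUS⇒IsMUS : ∀ {i j} → T (isMUS (i , j)) → IsMUS i j
  isMUS⇒IsMUS {i} {j} t =
    let valid-ij , rest = to T-∧ t
        unique-ij , checks = to T-∧ rest
    in record
      { isUnique = unique⇒IsUnique (valid⇒Valid valid-ij) unique-ij
      ; minimal = λ i≤i′ j′≤j u′ → notShorterOrRepeats-unique
          (all-lookup (all-lookup checks (∈-range⁺ i≤i′ (≤-trans (IsUnique.i≤j u′) j′≤j)))
                      (∈-range⁺ (IsUnique.i≤j u′) j′≤j))
          u′
      }

  isSUS⇒IsSUS : ∀ {p i j} → T (isSUS (p , p) (i , j)) → IsSUS p i j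
  isSUS⇒IsSUS {p} {i} {j} t =
    let valid-ij , rest = to T-∧ t
        unique-ij , rest = to T-∧ rest
        i≤ᵇp , rest = to T-∧ rest
        p≤ᵇj , checks = to T-∧ rest
    in record
      { isUnique = unique⇒IsUnique (valid⇒Valid valid-ij) unique-ij
      ; i≤p = ≤ᵇ⇒≤ i p i≤ᵇp
      ; p≤j = ≤ᵇ⇒≤ p j p≤ᵇj
      ; shortest = λ i′≤p p≤j′ u′ → notShorterOrRepeats-unique
          (all-lookup (all-lookup checks (∈-range⁺ (IsUnique.1≤i u′) i′≤p))
                      (∈-range⁺ p≤j′ (IsUnique.j≤n u′)))
          u′
      }

  inPS⇒IsSUS : ∀ {i j} → T (inPS (i , j)) → ∃ λ p → IsSUS p i j
  inPS⇒IsSUS t with find (any⁻ _ (range 1 n) t)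
  ... | p , _ , sus = p , isSUS⇒IsSUS sus

  ¬isMUS⇒shorter : ∀ {i j} → IsUnique i j → ¬ T (isMUS (i , j)) →
    ∃₂ λ i′ j′ → i ≤ i′ × j′ ≤ j × j′ ∸ i′ < j ∸ i × IsUnique i′ j′
  ¬isMUS⇒shorter {i} {j} u ¬mus
    with ¬all⇒∃¬ _ (range i j) (λ checks → ¬mus (from T-∧ (Valid⇒valid (IsUnique.bounds u) ,
                                                    from T-∧ (IsUnique⇒unique u , checks))))
  ... | i′ , i′∈ , ¬row with ¬all⇒∃¬ _ (range i′ j) ¬row
  ... | j′ , j′∈ , ¬cell =
    let i≤i′ , _ = ∈-range⁻ i′∈
        i′≤j′ , j′≤j = ∈-range⁻ j′∈
    in i′ , j′ , i≤i′ , j′≤j ,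
       ¬notShorterOrRepeats (mkValid (≤-trans (IsUnique.1≤i u) i≤i′) i′≤j′ (≤-trans j′≤j (IsUnique.j≤n u)))
                            ¬cell

  MUS-within : ∀ {i j} → IsUnique i j → ∃₂ λ a b → i ≤ a × b ≤ j × T (isMUS (a , b))
  MUS-within {i} {j} = go (suc (j ∸ i)) ≤-refl
    where
    go : ∀ fuel {i j} → j ∸ i < fuel → IsUnique i j → ∃₂ λ a b → i ≤ a × b ≤ j × T (isMUS (a , b))
    go (suc fuel) {i} {j} len<fuel u = descend (T? (isMUS (i , j)))
      where
      descend : Dec (T (isMUS (i , j))) → ∃₂ λ a b → i ≤ a × b ≤ j × T (isMUS (a , b))
      descend (yes mus) = i , j , ≤-refl , ≤-refl , mus
      descend (no ¬mus) =
        let i′ , j′ , i≤i′ , j′≤j , shorter , u′ = ¬isMUS⇒shorter u ¬mus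
            a , b , i′≤a , b≤j′ , mus = go fuel (<-≤-trans shorter (s≤s⁻¹ len<fuel)) u′
        in a , b , ≤-trans i≤i′ i′≤a , ≤-trans b≤j′ j′≤j , mus

  isMUS⇒∈intervals : ∀ {i j} → T (isMUS (i , j)) → (i , j) ∈ intervals
  isMUS⇒∈intervals {i} {j} mus =
    let mkValid 1≤i i≤j j≤n = valid⇒Valid {i} {j} (proj₁ (to T-∧ mus))
    in ∈-concat⁺′ (∈-map⁺ (i ,_) (∈-range⁺ i≤j j≤n))
                  (∈-map⁺ (λ i → map (i ,_) (range i n)) (∈-range⁺ 1≤i (≤-trans i≤j j≤n)))

  intervals-Unique : Unique intervals
  intervals-Unique = Unique.concat⁺ (All.map⁺ (All.tabulate (λ {i} _ → row-Unique i)))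
                                    (AllPairs.map⁺ (AllPairs.map rows-disjoint (range-Unique 1 n)))
    where
    row-Unique : ∀ i → Unique (map (i ,_) (range i n))
    row-Unique i = Unique.map⁺ (cong proj₂) (range-Unique i n)
    rows-disjoint : ∀ {i i′} → i ≢ i′ → ∀ {I} →
      ¬ (I ∈ map (i ,_) (range i n) × I ∈ map (i′ ,_) (range i′ n))
    rows-disjoint i≢i′ (I∈ , I∈′) with ∈-map⁻ (_ ,_) I∈ | ∈-map⁻ (_ ,_) I∈′
    ... | _ , _ , refl | _ , _ , refl = i≢i′ refl

  -- What the proof uses of a preimage [u,y] ∈ LS ∪ MS of u under f.
  record LeftAnchored (u i y : ℕ) : Set where
    field
      pos : ℕ
      sus : IsSUS pos u y
      u≤i : u ≤ i
      mus : T (isMUS (i , y))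

  -- What the proof uses of a preimage [x,u] ∈ RS of u under f.
  record RightAnchored (x u : ℕ) : Set where
    field
      sus : IsSUS u x u
      prefixEnd : ℕ
      prefixEnd<u : prefixEnd < u
      uniquePrefix : IsUnique x prefixEnd

  inLS∨inMS⇒MUS-suffix : ∀ {x y} → T (inLS (x , y) ∨ inMS (x , y)) →
    ∃ λ i → x ≤ i × T (isMUS (i , y))
  inLS∨inMS⇒MUS-suffix {x} {y} t = from-LS∪MS (to (T-∨ {inLS (x , y)}) t)
    where
    from-LS∪MS : T (inLS (x , y)) ⊎ T (inMS (x , y)) → ∃ λ i → x ≤ i × T (isMUS (i , y))
    from-LS∪MS (inj₂ ms) = x , ≤-refl , proj₂ (to (T-∧ {inPS (x , y)}) ms)
    from-LS∪MS (inj₁ ls) =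
      let _ , suffix = to (T-∧ {not (isMUS (x , y))}) (proj₂ (to (T-∧ {inPS (x , y)}) ls))
          i , _ , x<i∧mus = find (any⁻ (λ i → (x <ᵇ i) ∧ isMUS (i , y)) (range 1 n) suffix)
          x<ᵇi , mus = to (T-∧ {x <ᵇ i}) x<i∧mus
      in i , <⇒≤ (<ᵇ⇒< x i x<ᵇi) , mus

  MUS-suffix⇒inLS∨inMS : ∀ {x a u} → T (inPS (x , u)) → x ≤ a → T (isMUS (a , u)) →
    T (inLS (x , u) ∨ inMS (x , u))
  MUS-suffix⇒inLS∨inMS {x} {a} {u} ps x≤a mus = by-cases (T? (isMUS (x , u))) (m≤n⇒m<n∨m≡n x≤a)
    where
    inMS-xu : T (isMUS (x , u)) → T (inLS (x , u) ∨ inMS (x , u))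
    inMS-xu mus-xu = from (T-∨ {inLS (x , u)}) (inj₂ (from (T-∧ {inPS (x , u)}) (ps , mus-xu)))
    a∈ : a ∈ range 1 n
    a∈ = let mkValid 1≤a a≤u u≤n = valid⇒Valid {a} {u} (proj₁ (to (T-∧ {valid a u}) mus))
         in ∈-range⁺ 1≤a (≤-trans a≤u u≤n)
    by-cases : Dec (T (isMUS (x , u))) → x < a ⊎ x ≡ a → T (inLS (x , u) ∨ inMS (x , u))
    by-cases (yes mus-xu) _ = inMS-xu mus-xu
    by-cases (no _) (inj₂ x≡a) = inMS-xu (subst (λ c → T (isMUS (c , u))) (sym x≡a) mus)
    by-cases (no ¬mus-xu) (inj₁ x<a) =
      from (T-∨ {inLS (x , u)}) (inj₁ (from (T-∧ {inPS (x , u)}) (ps ,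
        from (T-∧ {not (isMUS (x , u))}) (¬T⇒T-not ¬mus-xu ,
          any⁺ (λ i → (x <ᵇ i) ∧ isMUS (i , u)) (lose a∈ (from (T-∧ {x <ᵇ a}) (<⇒<ᵇ x<a , mus)))))))

  -- [x,b] (if p ≤ b) or [a,p] (if b < p) is a unique interval through p, hence no shorter than the SUS [x,u];
  -- this forces a = x and p = u.
  unique-inside⇒RightAnchored : ∀ {p x u a b} → IsSUS p x u → x ≤ a → b < u → IsUnique a b →
    RightAnchored x u
  unique-inside⇒RightAnchored {p} {x} {u} {a} {b} sus x≤a b<u u-ab with p ≤? b
  ... | yes p≤b = ⊥-elim (<⇒≱ (∸-monoˡ-< b<u (≤-trans x≤a (IsUnique.i≤j u-ab)))
                              (IsSUS.shortest sus (IsSUS.i≤p sus) p≤b u-xb))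
    where
    u-xb = IsUnique-extendˡ (IsUnique.1≤i (IsSUS.isUnique sus)) x≤a u-ab
  ... | no p≰b = pinned (m≤n⇒m<n∨m≡n x≤a) (m≤n⇒m<n∨m≡n (IsSUS.p≤j sus))
    where
    b<p = ≰⇒> p≰b
    a≤p = ≤-trans (IsUnique.i≤j u-ab) (<⇒≤ b<p)
    a≤u = ≤-trans a≤p (IsSUS.p≤j sus)
    u∸x≤p∸a : u ∸ x ≤ p ∸ a
    u∸x≤p∸a = IsSUS.shortest sus a≤p ≤-refl
      (IsUnique-extendʳ (<⇒≤ b<p) (≤-trans (IsSUS.p≤j sus) (IsUnique.j≤n (IsSUS.isUnique sus))) u-ab)
    pinned : x < a ⊎ x ≡ a → p < u ⊎ p ≡ u → RightAnchored x u
    pinned (inj₂ x≡a) (inj₂ p≡u) = record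
      { sus = subst (λ q → IsSUS q x u) p≡u sus
      ; prefixEnd = b
      ; prefixEnd<u = b<u
      ; uniquePrefix = subst (λ c → IsUnique c b) (sym x≡a) u-ab
      }
    pinned (inj₁ x<a) _ = ⊥-elim (<⇒≱ (begin-strict
      p ∸ a ≤⟨ ∸-monoˡ-≤ a (IsSUS.p≤j sus) ⟩
      u ∸ a <⟨ ∸-monoʳ-< x<a a≤u ⟩
      u ∸ x ∎) u∸x≤p∸a)
      where open ≤-Reasoning
    pinned _ (inj₁ p<u) = ⊥-elim (<⇒≱ (begin-strict
      p ∸ a <⟨ ∸-monoˡ-< p<u a≤p ⟩
      u ∸ a ≤⟨ ∸-monoʳ-≤ u x≤a ⟩
      u ∸ x ∎) u∸x≤p∸a)
      where open ≤-Reasoning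

  RightAnchored-of-RS : ∀ {x u} → T (inPS (x , u)) → ¬ T (inLS (x , u) ∨ inMS (x , u)) → RightAnchored x u
  RightAnchored-of-RS ps ¬LM with inPS⇒IsSUS ps
  ... | p , sus with MUS-within (IsSUS.isUnique sus)
  ... | a , b , x≤a , b≤u , mus with m≤n⇒m<n∨m≡n b≤u
  ... | inj₂ refl = ⊥-elim (¬LM (MUS-suffix⇒inLS∨inMS ps x≤a mus))
  ... | inj₁ b<u = unique-inside⇒RightAnchored sus x≤a b<u (IsMUS.isUnique (isMUS⇒IsMUS mus))

  LeftAnchored-of-LS∪MS : ∀ {u y} → T (inPS (u , y)) → T (inLS (u , y) ∨ inMS (u , y)) →
    ∃ λ i → LeftAnchored u i y
  LeftAnchored-of-LS∪MS ps LM =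
    let p , sus = inPS⇒IsSUS ps
        i , u≤i , mus = inLS∨inMS⇒MUS-suffix LM
    in i , record { pos = p ; sus = sus ; u≤i = u≤i ; mus = mus }

  FiberMember : ℕ → ℕ → ℕ → Set
  FiberMember u x y = (x ≡ u × ∃ λ i → LeftAnchored u i y) ⊎ (y ≡ u × RightAnchored x u)

  fiber-member : ∀ {u x y} → T (inPS (x , y) ∧ (f (x , y) ≡ᵇ u)) → FiberMember u x y
  fiber-member {u} {x} {y} t = by-cases (T? (inLS (x , y) ∨ inMS (x , y)))
    where
    ps = proj₁ (to (T-∧ {inPS (x , y)}) t)
    f≡u : f (x , y) ≡ u
    f≡u = ≡ᵇ⇒≡ (f (x , y)) u (proj₂ (to (T-∧ {inPS (x , y)}) t))
    by-cases : Dec (T (inLS (x , y) ∨ inMS (x , y))) → FiberMember u x y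
    by-cases (yes LM) =
      inj₁ (x≡u , subst (λ v → ∃ λ i → LeftAnchored v i y) x≡u (LeftAnchored-of-LS∪MS ps LM))
      where
      x≡u : x ≡ u
      x≡u = trans (sym (if-T LM)) f≡u
    by-cases (no ¬LM) = inj₂ (y≡u , subst (RightAnchored x) y≡u (RightAnchored-of-RS ps ¬LM))
      where
      y≡u : y ≡ u
      y≡u = trans (sym (if-¬T ¬LM)) f≡u

  -- Each case exhibits a unique interval through the SUS position p of [u,y₂] that is shorter than [u,y₂],
  -- or, when i ≤ u, a unique proper part of the MUS [i,y₂].
  LeftAnchored-longer-absurd : ∀ {u y₁ i y₂} → IsUnique u y₁ → LeftAnchored u i y₂ → y₁ < y₂ → ⊥
  LeftAnchored-longer-absurd {u} {y₁} {i} {y₂} u-uy₁ L y₁<y₂ = cases (i ≤? u) (p ≤? y₁) (i ≤? p)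
    where
    open LeftAnchored L renaming (pos to p)
    u-iy₂ = IsMUS.isUnique (isMUS⇒IsMUS mus)
    y₁∸u<y₂∸u = ∸-monoˡ-< y₁<y₂ (IsUnique.i≤j u-uy₁)
    cases : Dec (i ≤ u) → Dec (p ≤ y₁) → Dec (i ≤ p) → ⊥
    cases (yes i≤u) _ _ = <⇒≱ (<-≤-trans y₁∸u<y₂∸u (∸-monoʳ-≤ y₂ i≤u))
      (IsMUS.minimal (isMUS⇒IsMUS mus) i≤u (<⇒≤ y₁<y₂) u-uy₁)
    cases (no _) (yes p≤y₁) _ = <⇒≱ y₁∸u<y₂∸u (IsSUS.shortest sus (IsSUS.i≤p sus) p≤y₁ u-uy₁)
    cases (no i≰u) (no _) (yes i≤p) =
      <⇒≱ (∸-monoʳ-< (≰⇒> i≰u) (IsUnique.i≤j u-iy₂)) (IsSUS.shortest sus i≤p (IsSUS.p≤j sus) u-iy₂)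
    cases (no _) (no p≰y₁) (no i≰p) =
      <⇒≱ (∸-monoʳ-< (≤-<-trans (IsUnique.i≤j u-uy₁) (≰⇒> p≰y₁)) (IsSUS.p≤j sus))
          (IsSUS.shortest sus ≤-refl (IsSUS.p≤j sus) (IsUnique-extendˡ 1≤p (<⇒≤ (≰⇒> i≰p)) u-iy₂))
      where
      1≤p = ≤-trans (IsUnique.1≤i u-uy₁) (IsSUS.i≤p sus)

  LeftAnchored-end-unique : ∀ {u i₁ y₁ i₂ y₂} → LeftAnchored u i₁ y₁ → LeftAnchored u i₂ y₂ → y₁ ≡ y₂
  LeftAnchored-end-unique L₁ L₂ = <-impossible⇒≡ {P = λ y → ∃ λ i → LeftAnchored _ i y}
    (λ (_ , L₁) (_ , L₂) → LeftAnchored-longer-absurd (IsSUS.isUnique (LeftAnchored.sus L₁)) L₂)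
    (_ , L₁) (_ , L₂)

  RightAnchored-start-unique : ∀ {x₁ x₂ u} → RightAnchored x₁ u → RightAnchored x₂ u → x₁ ≡ x₂
  RightAnchored-start-unique = <-impossible⇒≡ λ R₁ R₂ x₁<x₂ →
    let u-x₂u = IsSUS.isUnique (RightAnchored.sus R₂)
    in <⇒≱ (∸-monoʳ-< x₁<x₂ (IsUnique.i≤j u-x₂u))
           (IsSUS.shortest (RightAnchored.sus R₁) (IsUnique.i≤j u-x₂u) ≤-refl u-x₂u)

  -- u is charged to the MUS that ends its left preimage.
  Charged : ℕ → Interval → Set
  Charged u m = LeftAnchored u (proj₁ m) (proj₂ m) × ∃ λ x → RightAnchored x u

  distinct-fiber-members⇒Charged : ∀ {u x₁ y₁ x₂ y₂} → (x₁ , y₁) ≢ (x₂ , y₂) →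
    FiberMember u x₁ y₁ → FiberMember u x₂ y₂ → ∃ λ m → Charged u m
  distinct-fiber-members⇒Charged _ (inj₁ (refl , i , L)) (inj₂ (refl , R)) = _ , L , _ , R
  distinct-fiber-members⇒Charged _ (inj₂ (refl , R)) (inj₁ (refl , i , L)) = _ , L , _ , R
  distinct-fiber-members⇒Charged I₁≢I₂ (inj₁ (refl , _ , L₁)) (inj₁ (refl , _ , L₂)) =
    ⊥-elim (I₁≢I₂ (cong (_ ,_) (LeftAnchored-end-unique L₁ L₂)))
  distinct-fiber-members⇒Charged I₁≢I₂ (inj₂ (refl , R₁)) (inj₂ (refl , R₂)) =
    ⊥-elim (I₁≢I₂ (cong (_, _) (RightAnchored-start-unique R₁ R₂)))

  -- Each case exhibits a unique interval through the SUS position p of [u₁,y] that is shorter than [u₁,y]: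
  -- [u₂,y], [p,b₂] or [x₂, b₂ ⊔ p]; the last is shorter because [x₂,u₂] is a SUS of u₂ ∈ [u₁,y].
  Charged-<-absurd : ∀ {u₁ u₂ m} → Charged u₁ m → Charged u₂ m → u₁ < u₂ → ⊥
  Charged-<-absurd {u₁} {u₂} {i , y} (L₁ , _) (L₂ , x₂ , R₂) u₁<u₂ = cases (u₂ ≤? p) (p <? x₂)
    where
    open LeftAnchored L₁ using (sus) renaming (pos to p)
    open RightAnchored R₂ using (uniquePrefix) renaming (prefixEnd to b₂; prefixEnd<u to b₂<u₂)
    u-iy = IsMUS.isUnique (isMUS⇒IsMUS (LeftAnchored.mus L₂))
    u₂≤y = ≤-trans (LeftAnchored.u≤i L₂) (IsUnique.i≤j u-iy)
    1≤u₁ = IsUnique.1≤i (IsSUS.isUnique sus)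
    cases : Dec (u₂ ≤ p) → Dec (p < x₂) → ⊥
    cases (yes u₂≤p) _ = <⇒≱ (∸-monoʳ-< u₁<u₂ u₂≤y)
      (IsSUS.shortest sus u₂≤p (IsSUS.p≤j sus)
        (IsUnique-extendˡ (≤-trans 1≤u₁ (<⇒≤ u₁<u₂)) (LeftAnchored.u≤i L₂) u-iy))
    cases (no _) (yes p<x₂) = <⇒≱ (begin-strict
        b₂ ∸ p  ≤⟨ ∸-monoʳ-≤ b₂ (IsSUS.i≤p sus) ⟩
        b₂ ∸ u₁ <⟨ ∸-monoˡ-< (<-≤-trans b₂<u₂ u₂≤y) (≤-trans (IsSUS.i≤p sus) p≤b₂) ⟩
        y ∸ u₁  ∎)
      (IsSUS.shortest sus ≤-refl p≤b₂
        (IsUnique-extendˡ (≤-trans 1≤u₁ (IsSUS.i≤p sus)) (<⇒≤ p<x₂) uniquePrefix))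
      where
      open ≤-Reasoning
      p≤b₂ = ≤-trans (<⇒≤ p<x₂) (IsUnique.i≤j uniquePrefix)
    cases (no u₂≰p) (no p≮x₂) = <⇒≱ (begin-strict
        b₂ ⊔ p ∸ x₂ <⟨ ∸-monoˡ-< (⊔-lub b₂<u₂ (≰⇒> u₂≰p))
                                 (≤-trans (IsUnique.i≤j uniquePrefix) (m≤m⊔n b₂ p)) ⟩
        u₂ ∸ x₂     ≤⟨ IsSUS.shortest (RightAnchored.sus R₂) (<⇒≤ u₁<u₂) u₂≤y (IsSUS.isUnique sus) ⟩
        y ∸ u₁      ∎)
      (IsSUS.shortest sus (≮⇒≥ p≮x₂) (m≤n⊔m b₂ p) u-x₂[b₂⊔p])
      where
      open ≤-Reasoning
      u-x₂[b₂⊔p] = IsUnique-extendʳ (m≤m⊔n b₂ p)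
        (⊔-lub (IsUnique.j≤n uniquePrefix) (≤-trans (IsSUS.p≤j sus) (IsUnique.j≤n (IsSUS.isUnique sus))))
        uniquePrefix

  Charged-injective : ∀ {u₁ u₂ m} → Charged u₁ m → Charged u₂ m → u₁ ≡ u₂
  Charged-injective {m = m} = <-impossible⇒≡ {P = λ u → Charged u m} Charged-<-absurd

  Charged⇒earlier-MUS : ∀ {u m} → Charged u m → ∃₂ λ a b → b < proj₂ m × T (isMUS (a , b))
  Charged⇒earlier-MUS (L , _ , R) with MUS-within (RightAnchored.uniquePrefix R)
  ... | a , b , _ , b≤prefixEnd , mus = a , b , (begin-strict
      b                          ≤⟨ b≤prefixEnd ⟩
      RightAnchored.prefixEnd R  <⟨ RightAnchored.prefixEnd<u R ⟩
      _                          ≤⟨ LeftAnchored.u≤i L ⟩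
      _                          ≤⟨ IsUnique.i≤j (IsMUS.isUnique (isMUS⇒IsMUS (LeftAnchored.mus L))) ⟩
      _                          ∎) , mus
    where open ≤-Reasoning

  MUSs : List Interval
  MUSs = filterᵇ isMUS intervals

  U : List ℕ
  U = filterᵇ (λ u → fInvCard u ≡ᵇ 2) (range 1 n)

  isMUS⇒∈MUSs : ∀ {i j} → T (isMUS (i , j)) → (i , j) ∈ MUSs
  isMUS⇒∈MUSs mus = ∈-filterᵇ⁺ isMUS (isMUS⇒∈intervals mus) mus

  U⇒Charged : ∀ {u} → u ∈ U → ∃ λ m → m ∈ MUSs × Charged u m
  U⇒Charged {u} u∈U =
    let (x₁ , y₁) , (x₂ , y₂) , I₁≢I₂ , I₁∈ , I₂∈ =
          Unique⇒distinct (filterᵇ-Unique preimage intervals-Unique) 2≤|f⁻¹u|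
        (i , y) , L , R = distinct-fiber-members⇒Charged I₁≢I₂
          (fiber-member {u} {x₁} {y₁} (proj₂ (∈-filterᵇ⁻ preimage {intervals} I₁∈)))
          (fiber-member {u} {x₂} {y₂} (proj₂ (∈-filterᵇ⁻ preimage {intervals} I₂∈)))
    in (i , y) , isMUS⇒∈MUSs {i} {y} (LeftAnchored.mus L) , L , R
    where
    preimage : Interval → Bool
    preimage I = inPS I ∧ (f I ≡ᵇ u)
    2≤|f⁻¹u| : 2 ≤ length (filterᵇ preimage intervals)
    2≤|f⁻¹u| = ≤-reflexive (sym (≡ᵇ⇒≡ (fInvCard u) 2
      (proj₂ (∈-filterᵇ⁻ (λ u → fInvCard u ≡ᵇ 2) {range 1 n} u∈U))))

  cardU<cardM : 1 ≤ n → cardU < cardM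
  cardU<cardM 1≤n =
    length<-by-injection Charged (filterᵇ-Unique _ (range-Unique 1 n)) U⇒Charged Charged-injective
      earliest∈ earliest-uncharged
    where
    first : ∃₂ λ a b → 1 ≤ a × b ≤ n × T (isMUS (a , b))
    first = MUS-within (IsUnique-whole 1≤n)
    first∈ : (proj₁ first , proj₁ (proj₂ first)) ∈ MUSs
    first∈ = isMUS⇒∈MUSs (proj₂ (proj₂ (proj₂ (proj₂ first))))
    earliest : Interval
    earliest = argmin proj₂ (proj₁ first , proj₁ (proj₂ first)) MUSs
    earliest∈ : earliest ∈ MUSs
    earliest∈ with argmin-sel proj₂ (proj₁ first , proj₁ (proj₂ first)) MUSs
    ... | inj₁ earliest≡first = subst (_∈ MUSs) (sym earliest≡first) first∈
    ... | inj₂ ∈MUSs = ∈MUSs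
    earliest-uncharged : ∀ {u} → ¬ Charged u earliest
    earliest-uncharged c =
      let a , b , b<end , mus = Charged⇒earlier-MUS c
      in <⇒≱ b<end (All.lookup (f[argmin]≤f[xs] {f = proj₂} _ MUSs) (isMUS⇒∈MUSs {a} {b} mus))

lemma6 : {A : Set} (_≟_ : DecidableEquality A) (S : List A) → S ≢ [] →
    suc (Str.cardU _≟_ S) ≤ Str.cardM _≟_ S
lemma6 _≟_ [] S≢[] = ⊥-elim (S≢[] refl)
lemma6 _≟_ S@(_ ∷ _) _ = StringIntervals.cardU<cardM _≟_ S (s≤s z≤n)
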